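{- Let $\mathcal C$ and $\mathcal D$ be graded coalgebras over a field $\mathbb K$ with finite-dimensional graded pieces, with $\mathcal C$ connected, and suppose $\dim\mathcal D_n=1$ for every $n\ge0$ (i.e. $\mathcal D_n$ has a basis indexed by the unique comb with $n$ internal nodes). Let $C_n=\dim\mathcal C_n$ and $E_n=\dim(\mathcal D\circ\mathcal C)_n$. Then $E_0=1$ and for $n>0$, $E_n=C_n+\sum_{i=0}^{n-1}C_iE_{n-i-1}$.
   Context: A graded coalgebra $\mathcal C=\bigoplus_{n\ge0}\mathcal C_n$ is connected if $\mathcal C_0=\mathbb K$. For graded coalgebras $\mathcal C,\mathcal D$, $\mathcal D\circ\mathcal C:=\bigoplus_{n\ge0}\mathcal D_n\otimes\mathcal C^{\otimes(n+1)}$, graded so that $d\otimes c_0\otimes\cdots\otimes c_n$ (with $d\in\mathcal D_n$ and all entries homogeneous) has degree $|d|+|c_0|+\cdots+|c_n|$; $(\mathcal D\circ\mathcal C)_n$ is its degree-$n$ part. -}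

module Defs where

open import Data.Nat using (ℕ; zero; suc; _+_; _*_; _∸_)
open import Relation.Binary.PropositionalEquality using (_≡_)

-- A graded vector space with finite-dimensional graded pieces is recorded
-- by its dimension sequence  dim : ℕ → ℕ  (dim n = dimension of the degree-n piece).
-- The coalgebra structure plays no role in dimension counts.
DimSeq : Set
DimSeq = ℕ → ℕ

sumTo : ℕ → (ℕ → ℕ) → ℕ
sumTo zero    f = 0
sumTo (suc n) f = sumTo n f + f n

sumUpTo : ℕ → (ℕ → ℕ) → ℕ
sumUpTo n f = sumTo (suc n) f

-- dimension of the degree-s part of the tensor power C^{⊗m}:
-- (C^{⊗0})_s = K if s = 0 and 0 otherwise;
-- (C^{⊗(m+1)})_s = ⊕_{a+b=s} C_a ⊗ (C^{⊗m})_b.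
tensorPowDim : DimSeq → ℕ → ℕ → ℕ
tensorPowDim C zero    zero    = 1
tensorPowDim C zero    (suc s) = 0
tensorPowDim C (suc m) s       = sumUpTo s (λ a → C a * tensorPowDim C m (s ∸ a))

-- dimension of (D ∘ C)_n where D ∘ C = ⊕_{k≥0} D_k ⊗ C^{⊗(k+1)},
-- with d ⊗ c_0 ⊗ ... ⊗ c_k in degree |d| + |c_0| + ... + |c_k|.
-- Only k ≤ n contributes to degree n (all degrees are ≥ 0).
compDim : DimSeq → DimSeq → DimSeq
compDim D C n = sumUpTo n (λ k → D k * tensorPowDim C (suc k) (n ∸ k))

Connected : DimSeq → Set
Connected C = C 0 ≡ 1

{-# OPTIONS --safe #-}
-- With every D_k one-dimensional, E_n = Σ_{k ≤ n} dim (C^{⊗(k+1)})_{n-k}.  Splitting off the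
-- first tensor factor c_0 of degree i leaves exactly a summand of E_{n-1-i} (the remaining
-- k tensor factors together with the comb of size k-1), except when k = 0, where c_0 carries
-- the whole degree and contributes C_n.  The only real work is exchanging the two summations
-- over the triangle {(k, i) : k + i ≤ n - 1}.
module Submission where

open import Defs
open import Data.Nat using (ℕ; zero; suc; _+_; _*_; _∸_; _<_; s≤s)
open import Data.Nat.Properties
open import Data.Product using (_×_; _,_)
open import Function using (_∘_; flip)
open import Relation.Binary.PropositionalEquality
open import Algebra.Properties.CommutativeSemigroup +-commutativeSemigroup using (interchange)

open ≡-Reasoning

sumTo-cong-< : ∀ n {f g : ℕ → ℕ} → (∀ i → i < n → f i ≡ g i) → sumTo n f ≡ sumTo n g
sumTo-cong-< zero    f≡g = refl
sumTo-cong-< (suc n) f≡g =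
  cong₂ _+_ (sumTo-cong-< n (λ i i<n → f≡g i (m<n⇒m<1+n i<n))) (f≡g n ≤-refl)

sumTo-cong : ∀ n {f g : ℕ → ℕ} → (∀ i → f i ≡ g i) → sumTo n f ≡ sumTo n g
sumTo-cong n f≡g = sumTo-cong-< n (λ i _ → f≡g i)

sumTo-zero : ∀ n → sumTo n (λ _ → 0) ≡ 0
sumTo-zero zero    = refl
sumTo-zero (suc n) = trans (+-identityʳ _) (sumTo-zero n)

sumTo-distrib-+ : ∀ n (f g : ℕ → ℕ) → sumTo n (λ i → f i + g i) ≡ sumTo n f + sumTo n g
sumTo-distrib-+ zero    f g = refl
sumTo-distrib-+ (suc n) f g =
  trans (cong (_+ (f n + g n)) (sumTo-distrib-+ n f g)) (interchange (sumTo n f) (sumTo n g) (f n) (g n))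

*-distribˡ-sumTo : ∀ n c (f : ℕ → ℕ) → c * sumTo n f ≡ sumTo n (λ i → c * f i)
*-distribˡ-sumTo zero    c f = *-zeroʳ c
*-distribˡ-sumTo (suc n) c f =
  trans (*-distribˡ-+ c (sumTo n f) (f n)) (cong (_+ c * f n) (*-distribˡ-sumTo n c f))

sumTo-suc-unfoldˡ : ∀ n (f : ℕ → ℕ) → sumTo (suc n) f ≡ f 0 + sumTo n (f ∘ suc)
sumTo-suc-unfoldˡ zero    f = +-comm 0 (f 0)
sumTo-suc-unfoldˡ (suc n) f =
  trans (cong (_+ f (suc n)) (sumTo-suc-unfoldˡ n f)) (+-assoc (f 0) _ _)

suc-∸ : ∀ {n k} → k < suc n → suc n ∸ k ≡ suc (n ∸ k)
suc-∸ (s≤s k≤n) = +-∸-assoc 1 k≤n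

sumUpTo-reverse : ∀ n (f : ℕ → ℕ) → sumUpTo n f ≡ sumUpTo n (λ k → f (n ∸ k))
sumUpTo-reverse zero    f = refl
sumUpTo-reverse (suc n) f = begin
  sumUpTo (suc n) f
    ≡⟨ sumTo-suc-unfoldˡ (suc n) f ⟩
  f 0 + sumUpTo n (f ∘ suc)
    ≡⟨ cong (f 0 +_) (sumUpTo-reverse n (f ∘ suc)) ⟩
  f 0 + sumUpTo n (λ k → f (suc (n ∸ k)))
    ≡⟨ +-comm (f 0) _ ⟩
  sumUpTo n (λ k → f (suc (n ∸ k))) + f 0
    ≡⟨ cong₂ _+_ (sumTo-cong-< (suc n) λ k k<sn → cong f (sym (suc-∸ k<sn)))
                 (cong f (sym (n∸n≡0 (suc n)))) ⟩
  sumUpTo (suc n) (λ k → f (suc n ∸ k)) ∎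

antidiagonalSum : ℕ → (ℕ → ℕ → ℕ) → ℕ
antidiagonalSum n h = sumUpTo n (λ k → h k (n ∸ k))

triangleSum : ℕ → (ℕ → ℕ → ℕ) → ℕ
triangleSum m h = sumUpTo m (λ k → sumUpTo (m ∸ k) (h k))

antidiagonalSum-swap : ∀ n h → antidiagonalSum n h ≡ antidiagonalSum n (flip h)
antidiagonalSum-swap n h = trans (sumUpTo-reverse n (λ k → h k (n ∸ k)))
  (sumTo-cong-< (suc n) λ k k<sn → cong (h (n ∸ k)) (m∸[m∸n]≡n (≤-pred k<sn)))

triangleSum-suc : ∀ m h → triangleSum (suc m) h ≡ triangleSum m h + antidiagonalSum (suc m) h
triangleSum-suc m h = begin
  triangleSum (suc m) h
    ≡⟨ cong₂ _+_ (sumTo-cong-< (suc m) λ k k<sm → cong (λ x → sumUpTo x (h k)) (suc-∸ k<sm))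
                 (cong (λ x → sumUpTo x (h (suc m))) (n∸n≡0 m)) ⟩
  sumUpTo m (λ k → sumUpTo (m ∸ k) (h k) + h k (suc (m ∸ k))) + (0 + h (suc m) 0)
    ≡⟨ cong (_+ h (suc m) 0) (sumTo-distrib-+ (suc m) _ _) ⟩
  (triangleSum m h + sumUpTo m (λ k → h k (suc (m ∸ k)))) + h (suc m) 0
    ≡⟨ +-assoc (triangleSum m h) _ _ ⟩
  triangleSum m h + (sumUpTo m (λ k → h k (suc (m ∸ k))) + h (suc m) 0)
    ≡⟨ cong (triangleSum m h +_) (cong₂ _+_ (sumTo-cong-< (suc m) λ k k<sm → cong (h k) (sym (suc-∸ k<sm)))
                                            (cong (h (suc m)) (sym (n∸n≡0 (suc m))))) ⟩
  triangleSum m h + antidiagonalSum (suc m) h ∎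

triangleSum-swap : ∀ m h → triangleSum m h ≡ triangleSum m (flip h)
triangleSum-swap zero    h = refl
triangleSum-swap (suc m) h = begin
  triangleSum (suc m) h
    ≡⟨ triangleSum-suc m h ⟩
  triangleSum m h + antidiagonalSum (suc m) h
    ≡⟨ cong₂ _+_ (triangleSum-swap m h) (antidiagonalSum-swap (suc m) h) ⟩
  triangleSum m (flip h) + antidiagonalSum (suc m) (flip h)
    ≡⟨ triangleSum-suc m (flip h) ⟨
  triangleSum (suc m) (flip h) ∎

∸-comm : ∀ m i j → m ∸ i ∸ j ≡ m ∸ j ∸ i
∸-comm m i j = begin
  m ∸ i ∸ j    ≡⟨ ∸-+-assoc m i j ⟩
  m ∸ (i + j)  ≡⟨ cong (m ∸_) (+-comm i j) ⟩
  m ∸ (j + i)  ≡⟨ ∸-+-assoc m j i ⟨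
  m ∸ j ∸ i    ∎

tensorPowDim-one : ∀ C s → tensorPowDim C 1 s ≡ C s
tensorPowDim-one C s = begin
  sumTo s (λ a → C a * tensorPowDim C 0 (s ∸ a)) + C s * tensorPowDim C 0 (s ∸ s)
    ≡⟨ cong₂ _+_ (trans (sumTo-cong-< s vanishes) (sumTo-zero s))
                 (cong (λ x → C s * tensorPowDim C 0 x) (n∸n≡0 s)) ⟩
  C s * 1 ≡⟨ *-identityʳ (C s) ⟩
  C s     ∎
  where
  vanishes : ∀ a → a < s → C a * tensorPowDim C 0 (s ∸ a) ≡ 0
  vanishes a (s≤s a≤s) rewrite +-∸-assoc 1 a≤s = *-zeroʳ (C a)

combCompDim : DimSeq → DimSeq
combCompDim C n = sumUpTo n (λ k → tensorPowDim C (suc k) (n ∸ k))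

compDim-comb : ∀ C D → (∀ n → D n ≡ 1) → ∀ n → compDim D C n ≡ combCompDim C n
compDim-comb C D D≡1 n = sumTo-cong (suc n) λ k → trans (cong (_* _) (D≡1 k)) (+-identityʳ _)

combCompDim-suc : ∀ C m →
  combCompDim C (suc m) ≡ C (suc m) + sumUpTo m (λ i → C i * combCompDim C (m ∸ i))
combCompDim-suc C m = begin
  combCompDim C (suc m)
    ≡⟨ sumTo-suc-unfoldˡ (suc m) _ ⟩
  tensorPowDim C 1 (suc m) + triangleSum m (λ k i → C i * tensorPowDim C (suc k) (m ∸ k ∸ i))
    ≡⟨ cong₂ _+_ (tensorPowDim-one C (suc m)) (triangleSum-swap m _) ⟩
  C (suc m) + triangleSum m (λ i k → C i * tensorPowDim C (suc k) (m ∸ k ∸ i))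
    ≡⟨ cong (C (suc m) +_) (sumTo-cong (suc m) factorOut) ⟩
  C (suc m) + sumUpTo m (λ i → C i * combCompDim C (m ∸ i)) ∎
  where
  factorOut : ∀ i → sumUpTo (m ∸ i) (λ k → C i * tensorPowDim C (suc k) (m ∸ k ∸ i))
                  ≡ C i * combCompDim C (m ∸ i)
  factorOut i = begin
    sumUpTo (m ∸ i) (λ k → C i * tensorPowDim C (suc k) (m ∸ k ∸ i))
      ≡⟨ sumTo-cong (suc (m ∸ i)) (λ k → cong (λ x → C i * tensorPowDim C (suc k) x) (∸-comm m k i)) ⟩
    sumUpTo (m ∸ i) (λ k → C i * tensorPowDim C (suc k) (m ∸ i ∸ k))
      ≡⟨ *-distribˡ-sumTo (suc (m ∸ i)) (C i) _ ⟨
    C i * combCompDim C (m ∸ i) ∎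

mainTheorem3 : (C D : DimSeq) → Connected C → (∀ n → D n ≡ 1) →
    (compDim D C 0 ≡ 1) ×
    (∀ n → compDim D C (suc n) ≡ C (suc n) + sumTo (suc n) (λ i → C i * compDim D C (suc n ∸ i ∸ 1)))
mainTheorem3 C D C₀≡1 D≡1 = degreeZero , recurrence
  where
  E≡ : ∀ n → compDim D C n ≡ combCompDim C n
  E≡ = compDim-comb C D D≡1

  degreeZero : compDim D C 0 ≡ 1
  degreeZero rewrite D≡1 0 | C₀≡1 = refl

  recurrence : ∀ n → compDim D C (suc n) ≡ C (suc n) + sumTo (suc n) (λ i → C i * compDim D C (suc n ∸ i ∸ 1))
  recurrence n = begin
    compDim D C (suc n)
      ≡⟨ E≡ (suc n) ⟩
    combCompDim C (suc n)
      ≡⟨ combCompDim-suc C n ⟩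
    C (suc n) + sumUpTo n (λ i → C i * combCompDim C (n ∸ i))
      ≡⟨ cong (C (suc n) +_) (sumTo-cong (suc n) λ i →
           cong (C i *_) (trans (sym (E≡ (n ∸ i))) (cong (compDim D C) (sym (∸-suc i))))) ⟩
    C (suc n) + sumTo (suc n) (λ i → C i * compDim D C (suc n ∸ i ∸ 1)) ∎
    where
    ∸-suc : ∀ i → suc n ∸ i ∸ 1 ≡ n ∸ i
    ∸-suc i = trans (∸-+-assoc (suc n) i 1) (cong (suc n ∸_) (+-comm i 1))
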